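{- Let $G$ and $H$ be graphs, each with at least one vertex. Then the join $G\nabla H$ is a square if and only if at least one of $G,H$ either is a square, or is not connected and has two isomorphic connected components.
   Context: The join $G\nabla H$ has vertex set $V(G)\sqcup V(H)$ and edge set $E(G)\cup E(H)\cup\{gh: g\in V(G),h\in V(H)\}$. All graphs are finite and simple. A partially labeled graph is a graph $K$ together with an injective map $\theta: L\to V(K)$, $L\subseteq\mathbb{N}$, whose image $\theta(L)$ is nonempty and a proper subset of $V(K)$; vertices in $\theta(L)$ are labeled. The square $KK$ is obtained from two disjoint copies of $K$ by identifying each labeled vertex $\theta(\ell)$ of the first copy with $\theta(\ell)$ of the second copy (keeping all edges, merging double edges). A graph is a square if it is isomorphic to $KK$ for some partially labeled graph $K$. -}

module Defs where

open import Data.Nat using (ℕ; _+_)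
open import Data.Fin using (Fin; splitAt)
open import Data.Bool using (Bool; true; false; _∧_; _∨_; not; if_then_else_)
open import Data.Bool.Properties using (∧-comm)
open import Data.Sum using (_⊎_; inj₁; inj₂)
open import Data.Product using (Σ; ∃; ∃-syntax; _×_; _,_; proj₁; proj₂)
open import Relation.Nullary using (¬_)
open import Relation.Binary.PropositionalEquality using (_≡_; refl)

record Graph : Set where
  field
    n      : ℕ
    adj    : Fin n → Fin n → Bool
    sym    : ∀ i j → adj i j ≡ adj j i
    irrefl : ∀ i → adj i i ≡ false
open Graph public

record _≅_ (G H : Graph) : Set where
  field
    to      : Fin (n G) → Fin (n H)
    from    : Fin (n H) → Fin (n G)
    from∘to : ∀ x → from (to x) ≡ x
    to∘from : ∀ y → to (from y) ≡ y
    adj-pres : ∀ x y → adj G x y ≡ adj H (to x) (to y)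

joinAdj : (G H : Graph) → Fin (n G) ⊎ Fin (n H) → Fin (n G) ⊎ Fin (n H) → Bool
joinAdj G H (inj₁ a) (inj₁ b) = adj G a b
joinAdj G H (inj₂ a) (inj₂ b) = adj H a b
joinAdj G H (inj₁ a) (inj₂ b) = true
joinAdj G H (inj₂ a) (inj₁ b) = true

joinAdj-sym : ∀ G H s t → joinAdj G H s t ≡ joinAdj G H t s
joinAdj-sym G H (inj₁ a) (inj₁ b) = sym G a b
joinAdj-sym G H (inj₂ a) (inj₂ b) = sym H a b
joinAdj-sym G H (inj₁ a) (inj₂ b) = refl
joinAdj-sym G H (inj₂ a) (inj₁ b) = refl

joinAdj-irrefl : ∀ G H s → joinAdj G H s s ≡ false
joinAdj-irrefl G H (inj₁ a) = irrefl G a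
joinAdj-irrefl G H (inj₂ a) = irrefl H a

_∇_ : Graph → Graph → Graph
G ∇ H = record
  { n = n G + n H
  ; adj = λ x y → joinAdj G H (splitAt (n G) x) (splitAt (n G) y)
  ; sym = λ x y → joinAdj-sym G H (splitAt (n G) x) (splitAt (n G) y)
  ; irrefl = λ x → joinAdj-irrefl G H (splitAt (n G) x)
  }

data Reach (G : Graph) : Fin (n G) → Fin (n G) → Set where
  here : ∀ {x} → Reach G x x
  step : ∀ {x y z} → adj G x y ≡ true → Reach G y z → Reach G x z

Connected : Graph → Set
Connected G = ∀ x y → Reach G x y

-- The connected component of u is the induced subgraph on {x | Reach G u x}.
record ComponentIso (G : Graph) (u v : Fin (n G)) : Set where
  field
    f   : Fin (n G) → Fin (n G)
    g   : Fin (n G) → Fin (n G)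
    f-into : ∀ x → Reach G u x → Reach G v (f x)
    g-into : ∀ y → Reach G v y → Reach G u (g y)
    g∘f : ∀ x → Reach G u x → g (f x) ≡ x
    f∘g : ∀ y → Reach G v y → f (g y) ≡ y
    adj-pres : ∀ x x' → Reach G u x → Reach G u x' → adj G x x' ≡ adj G (f x) (f x')

HasTwoIsoComponents : Graph → Set
HasTwoIsoComponents G =
  ∃[ u ] ∃[ v ] (¬ Reach G u v × ComponentIso G u v)

-- A partially labeled graph: a graph K with a set of labeled vertices
-- (lab v ≡ true), nonempty and proper.  (The labels themselves only serve
-- to match vertices of the two copies with themselves, so only the set of
-- labeled vertices matters.)
--
-- The square KK: vertices are pairs (v , c), v ∈ V(K), c ∈ Bool (the copy),
-- with (v , true) identified with (v , false) when v is labeled.  We use the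
-- canonical representative: labeled vertices always carry c = false.

canon : {k : ℕ} → (Fin k → Bool) → Fin k × Bool → Fin k × Bool
canon lab (v , c) = (v , (not (lab v) ∧ c))

sameCopy : Bool → Bool → Bool
sameCopy true true = true
sameCopy false false = true
sameCopy _ _ = false

-- classes [v,c] and [w,d] are adjacent in KK iff some representatives
-- lie in the same copy and are adjacent in K.
KKadj : (K : Graph) → (Fin (n K) → Bool) → Fin (n K) × Bool → Fin (n K) × Bool → Bool
KKadj K lab (v , c) (w , d) = adj K v w ∧ (sameCopy c d ∨ lab v ∨ lab w)

record IsoToSquare (G K : Graph) (lab : Fin (n K) → Bool) : Set where
  field
    to       : Fin (n G) → Fin (n K) × Bool
    from     : Fin (n K) × Bool → Fin (n G)
    to-canon : ∀ x → canon lab (to x) ≡ to x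
    from∘to  : ∀ x → from (to x) ≡ x
    to∘from  : ∀ p → to (from p) ≡ canon lab p
    adj-pres : ∀ x y → adj G x y ≡ KKadj K lab (to x) (to y)

IsSquare : Graph → Set
IsSquare G =
  Σ Graph λ K → Σ (Fin (n K) → Bool) λ lab →
    (∃[ v ] lab v ≡ true) × (∃[ v ] lab v ≡ false) × IsoToSquare G K lab

{-# OPTIONS --safe #-}
module Submission where

-- G is the square KK exactly when it carries a copy swap: an involutive automorphism σ
-- together with a partition of the vertices into labelled ones (fixed by σ) and first and
-- second ones (exchanged by σ), with no edge between a first and a second vertex, and with
-- labelled and first vertices present; KK is recovered from the subgraph K induced by the
-- labelled and first vertices.
--
-- In G ∇ H every vertex of G is adjacent to every vertex of H, so all first and second
-- vertices of a copy swap of G ∇ H lie on one side, say G, and σ restricts to G. If some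
-- vertex of G is labelled, G is a square. Otherwise first vertices are only adjacent to
-- first vertices, so a first vertex v and σ v lie in different components, which σ maps
-- isomorphically onto each other. Conversely, a copy swap of G, or the swap of two
-- isomorphic components of G, extends to G ∇ H by labelling all of H.

open import Defs
open import Data.Nat using (ℕ; _≥_)
open import Data.Bool using (Bool; true; false; _∧_; _∨_; not; if_then_else_)
open import Data.Bool.Properties using (∧-identityʳ; ∧-zeroʳ; ∨-zeroʳ) renaming (_≟_ to _≟ᵇ_)
open import Data.Fin using (Fin; zero; suc; fromℕ<)
open import Data.Fin.Properties using (_≟_; any?; +↔⊎)
open import Data.Fin.Subset using (Subset; _∈_; _∉_; _∪_; ⁅_⁆; _⊃_)
open import Data.Fin.Subset.Properties using (_∈?_; x∈p∪q⁺; x∈p∪q⁻; p⊆p∪q; x∈⁅x⁆; x∈⁅y⁆⇒x≡y)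
open import Data.Fin.Subset.Induction using (Acc; acc; ⊃-wellFounded)
open import Data.List using (List; _∷_; length; filter; allFin; lookup)
open import Data.List.Membership.Propositional using () renaming (_∈_ to _∈ˡ_)
open import Data.List.Membership.Propositional.Properties using (∈-filter⁺; ∈-filter⁻; ∈-allFin; ∈-lookup)
open import Data.List.Membership.Setoid.Properties using (unique⇒irrelevant)
open import Data.List.Relation.Unary.Any using (index)
open import Data.List.Relation.Unary.Any.Properties using (lookup-index)
open import Data.List.Relation.Unary.Unique.Propositional.Properties using (filter⁺; allFin⁺)
open import Data.Product using (Σ-syntax; ∃-syntax; _×_; _,_; proj₁; proj₂)
open import Data.Sum using (_⊎_; inj₁; inj₂; [_,_]; map₁; swap)
open import Data.Sum.Properties using (swap-↔; inj₁-injective)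
open import Data.Sum.Function.Propositional using (_⊎-⇔_)
open import Function.Base using (_∘_; const)
open import Function.Bundles using (_↔_; _⇔_; mk⇔; Inverse)
open import Function.Properties.Inverse using (↔-sym)
open import Function.Properties.Equivalence using () renaming (trans to ⇔-trans; sym to ⇔-sym)
open import Relation.Nullary using (¬_; Dec; yes; no; ¬?; _×-dec_)
open import Relation.Nullary.Decidable using (map′)
open import Relation.Nullary.Negation using (contradiction)
open import Relation.Binary.PropositionalEquality using (_≡_; _≢_; refl; cong; cong₂; trans; subst; setoid; module ≡-Reasoning) renaming (sym to ≡-sym)
open import Axiom.UniquenessOfIdentityProofs using (module Decidable⇒UIP)

module _ {G : Graph} where

  Reach-snoc : ∀ {x y z} → Reach G x y → adj G y z ≡ true → Reach G x z
  Reach-snoc here e = step e here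
  Reach-snoc (step e r) e′ = step e (Reach-snoc r e′)

  Reach-trans : ∀ {x y z} → Reach G x y → Reach G y z → Reach G x z
  Reach-trans here r = r
  Reach-trans (step e r) r′ = step e (Reach-trans r r′)

  Reach-sym : ∀ {x y} → Reach G x y → Reach G y x
  Reach-sym here = here
  Reach-sym (step {x} {y} e r) = Reach-snoc (Reach-sym r) (trans (sym G y x) e)

  Reach-boundary : ∀ {w x y} → Reach G w x → ¬ Reach G w y → adj G x y ≡ false
  Reach-boundary {x = x} {y} wx w↛y with adj G x y in e
  ... | true = contradiction (Reach-snoc wx e) w↛y
  ... | false = refl

module _ (G : Graph) where

  Closed : Subset (n G) → Set
  Closed S = ∀ {x y} → x ∈ S → adj G x y ≡ true → y ∈ S

  Exit : Subset (n G) → Set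
  Exit S = ∃[ x ] ∃[ y ] (x ∈ S × adj G x y ≡ true × y ∉ S)

  exit-or-closed : ∀ S → Exit S ⊎ Closed S
  exit-or-closed S with any? (λ x → any? (λ y → x ∈? S ×-dec (adj G x y ≟ᵇ true) ×-dec ¬? (y ∈? S)))
  ... | yes exit = inj₁ exit
  ... | no ¬exit = inj₂ closed
    where
    closed : Closed S
    closed {x} {y} x∈S e with y ∈? S
    ... | yes y∈S = y∈S
    ... | no y∉S = contradiction (x , y , x∈S , e , y∉S) ¬exit

  record ReachableSet (u : Fin (n G)) : Set where
    field
      members : Subset (n G)
      source : u ∈ members
      sound : ∀ {x} → x ∈ members → Reach G u x
      closed : Closed members

    complete : ∀ {x y} → x ∈ members → Reach G x y → y ∈ members
    complete x∈S here = x∈S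
    complete x∈S (step e r) = complete (closed x∈S e) r

  reachableSet : ∀ u → ReachableSet u
  reachableSet u = grow ⁅ u ⁆ (⊃-wellFounded _) (x∈⁅x⁆ u) singleton-sound
    where
    singleton-sound : ∀ {x} → x ∈ ⁅ u ⁆ → Reach G u x
    singleton-sound x∈⁅u⁆ = subst (Reach G u) (≡-sym (x∈⁅y⁆⇒x≡y u x∈⁅u⁆)) here

    grow : ∀ S → Acc _⊃_ S → u ∈ S → (∀ {x} → x ∈ S → Reach G u x) → ReachableSet u
    grow S (acc larger) u∈S sound with exit-or-closed S
    ... | inj₂ closed = record { members = S ; source = u∈S ; sound = sound ; closed = closed }
    ... | inj₁ (x , y , x∈S , e , y∉S) =
      grow (S ∪ ⁅ y ⁆) (larger (p⊆p∪q ⁅ y ⁆ , y , x∈p∪q⁺ (inj₂ (x∈⁅x⁆ y)) , y∉S))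
           (p⊆p∪q ⁅ y ⁆ u∈S) sound′
      where
      sound′ : ∀ {z} → z ∈ S ∪ ⁅ y ⁆ → Reach G u z
      sound′ z∈S∪y with x∈p∪q⁻ S ⁅ y ⁆ z∈S∪y
      ... | inj₁ z∈S = sound z∈S
      ... | inj₂ z∈⁅y⁆ = subst (Reach G u) (≡-sym (x∈⁅y⁆⇒x≡y y z∈⁅y⁆)) (Reach-snoc (sound x∈S) e)

  Reach? : ∀ u x → Dec (Reach G u x)
  Reach? u x = map′ sound (complete source) (x ∈? members)
    where open ReachableSet (reachableSet u)

index-∈-lookup : ∀ {A : Set} (xs : List A) i → index (∈-lookup {xs = xs} i) ≡ i
index-∈-lookup (x ∷ xs) zero = refl
index-∈-lookup (x ∷ xs) (suc i) = cong suc (index-∈-lookup xs i)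

module Enumeration {k : ℕ} (p : Fin k → Bool) where

  private
    members : List (Fin k)
    members = filter (λ x → p x ≟ᵇ true) (allFin k)

    member : ∀ x → p x ≡ true → x ∈ˡ members
    member x = ∈-filter⁺ (λ x → p x ≟ᵇ true) (∈-allFin x)

    ∈-irrelevant : ∀ {x} (a b : x ∈ˡ members) → a ≡ b
    ∈-irrelevant = unique⇒irrelevant (setoid (Fin k)) (Decidable⇒UIP.≡-irrelevant _≟_) (filter⁺ _ (allFin⁺ k))

  size : ℕ
  size = length members

  element : Fin size → Fin k
  element = lookup members

  element-p : ∀ i → p (element i) ≡ true
  element-p i = proj₂ (∈-filter⁻ (λ x → p x ≟ᵇ true) {xs = allFin k} (∈-lookup i))

  position : ∀ x → p x ≡ true → Fin size
  position x px = index (member x px)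

  element-position : ∀ x px → element (position x px) ≡ x
  element-position x px = ≡-sym (lookup-index (member x px))

  position-element : ∀ {x} i px → element i ≡ x → position x px ≡ i
  position-element i px refl = trans (cong index (∈-irrelevant _ _)) (index-∈-lookup members i)

data Part : Set where
  labelled first second : Part

opposite : Part → Part
opposite labelled = labelled
opposite first = second
opposite second = first

labelled? : ∀ p → Dec (p ≡ labelled)
labelled? labelled = yes refl
labelled? first = no λ ()
labelled? second = no λ ()

record CopySwap {V : Set} (E : V → V → Bool) : Set where
  field
    σ : V → V
    part : V → Part
    σ-involutive : ∀ x → σ (σ x) ≡ x
    σ-automorphism : ∀ x y → E x y ≡ E (σ x) (σ y)
    σ-fixes-labelled : ∀ {x} → part x ≡ labelled → σ x ≡ x
    part-σ : ∀ x → part (σ x) ≡ opposite (part x)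
    first-second-nonadjacent : ∀ {x y} → part x ≡ first → part y ≡ second → E x y ≡ false

NontrivialCopySwap : {V : Set} → (V → V → Bool) → Set
NontrivialCopySwap E = Σ[ C ∈ CopySwap E ] ∃[ x ] CopySwap.part C x ≡ first

record ProperCopySwap {V : Set} (E : V → V → Bool) : Set where
  field
    copySwap : CopySwap E
  open CopySwap copySwap public
  field
    labelled-vertex : ∃[ x ] part x ≡ labelled
    first-vertex : ∃[ x ] part x ≡ first

  nontrivial : NontrivialCopySwap E
  nontrivial = copySwap , first-vertex

involution-preserving-edges⇒automorphism : ∀ {V : Set} {E : V → V → Bool} {σ : V → V} →
  (∀ x → σ (σ x) ≡ x) → (∀ {x y} → E x y ≡ true → E (σ x) (σ y) ≡ true) →
  ∀ x y → E x y ≡ E (σ x) (σ y)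
involution-preserving-edges⇒automorphism {E = E} {σ} involutive preserves x y with E x y in exy | E (σ x) (σ y) in eσ
... | true | true = refl
... | false | false = refl
... | true | false = contradiction (trans (≡-sym (preserves exy)) eσ) λ ()
... | false | true =
  contradiction (trans (≡-sym (preserves eσ)) (trans (cong₂ E (involutive x) (involutive y)) exy)) λ ()

Preserves : ∀ {V W : Set} → V ↔ W → (V → V → Bool) → (W → W → Bool) → Set
Preserves I E F = ∀ a b → E a b ≡ F (Inverse.to I a) (Inverse.to I b)

Preserves-sym : ∀ {V W : Set} {E F} (I : V ↔ W) → Preserves I E F → Preserves (↔-sym I) F E
Preserves-sym {E = E} {F} I preserves a b = begin
  F a b                          ≡⟨ cong₂ F (strictlyInverseˡ a) (strictlyInverseˡ b) ⟨
  F (to (from a)) (to (from b))  ≡⟨ preserves (from a) (from b) ⟨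
  E (from a) (from b)            ∎
  where
  open Inverse I
  open ≡-Reasoning

transportCopySwap : ∀ {V W : Set} {E F} (I : V ↔ W) → Preserves I E F → ProperCopySwap E → ProperCopySwap F
transportCopySwap {W = W} {E} {F} I preserves S = record
  { copySwap = record
    { σ = σ′
    ; part = part ∘ from
    ; σ-involutive = λ w →
        trans (cong (to ∘ σ) (strictlyInverseʳ _)) (trans (cong to (σ-involutive _)) (strictlyInverseˡ w))
    ; σ-automorphism = automorphism
    ; σ-fixes-labelled = λ e → trans (cong to (σ-fixes-labelled e)) (strictlyInverseˡ _)
    ; part-σ = λ w → trans (cong part (strictlyInverseʳ _)) (part-σ (from w))
    ; first-second-nonadjacent = λ ex ey → trans (Preserves-sym I preserves _ _) (first-second-nonadjacent ex ey)
    }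
  ; labelled-vertex = to (proj₁ labelled-vertex) , trans (cong part (strictlyInverseʳ _)) (proj₂ labelled-vertex)
  ; first-vertex = to (proj₁ first-vertex) , trans (cong part (strictlyInverseʳ _)) (proj₂ first-vertex)
  }
  where
  open Inverse I
  open ProperCopySwap S

  σ′ : W → W
  σ′ w = to (σ (from w))

  automorphism : ∀ a b → F a b ≡ F (σ′ a) (σ′ b)
  automorphism a b = begin
    F a b                        ≡⟨ Preserves-sym I preserves a b ⟩
    E (from a) (from b)          ≡⟨ σ-automorphism (from a) (from b) ⟩
    E (σ (from a)) (σ (from b))  ≡⟨ preserves _ _ ⟩
    F (σ′ a) (σ′ b)              ∎
    where open ≡-Reasoning

transportCopySwap-⇔ : ∀ {V W : Set} {E F} (I : V ↔ W) → Preserves I E F → ProperCopySwap E ⇔ ProperCopySwap F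
transportCopySwap-⇔ I preserves =
  mk⇔ (transportCopySwap I preserves) (transportCopySwap (↔-sym I) (Preserves-sym I preserves))

restrictCopySwapˡ : ∀ {V W : Set} {E : V ⊎ W → V ⊎ W → Bool} (C : CopySwap E) →
  (∀ v → ∃[ v′ ] CopySwap.σ C (inj₁ v) ≡ inj₁ v′) → CopySwap (λ a b → E (inj₁ a) (inj₁ b))
restrictCopySwapˡ {E = E} C σ-inj₁ = record
  { σ = σˡ
  ; part = part ∘ inj₁
  ; σ-involutive = λ v → inj₁-injective (begin
      inj₁ (σˡ (σˡ v))   ≡⟨ σˡ-inj₁ (σˡ v) ⟨
      σ (inj₁ (σˡ v))    ≡⟨ cong σ (σˡ-inj₁ v) ⟨
      σ (σ (inj₁ v))     ≡⟨ σ-involutive (inj₁ v) ⟩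
      inj₁ v             ∎)
  ; σ-automorphism = λ a b → trans (σ-automorphism (inj₁ a) (inj₁ b)) (cong₂ E (σˡ-inj₁ a) (σˡ-inj₁ b))
  ; σ-fixes-labelled = λ {v} e → inj₁-injective (trans (≡-sym (σˡ-inj₁ v)) (σ-fixes-labelled e))
  ; part-σ = λ v → trans (cong part (≡-sym (σˡ-inj₁ v))) (part-σ (inj₁ v))
  ; first-second-nonadjacent = first-second-nonadjacent
  }
  where
  open CopySwap C
  open ≡-Reasoning

  σˡ : _ → _
  σˡ v = proj₁ (σ-inj₁ v)

  σˡ-inj₁ : ∀ v → σ (inj₁ v) ≡ inj₁ (σˡ v)
  σˡ-inj₁ v = proj₂ (σ-inj₁ v)

module SquareCopySwap (K : Graph) (lab : Fin (n K) → Bool) where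

  Vertex : Set
  Vertex = Fin (n K) × Bool

  flip : Vertex → Vertex
  flip (v , c) = canon lab (v , not c)

  partOf : Vertex → Part
  partOf (v , c) = if lab v then labelled else (if c then second else first)

  canon-flip : ∀ p → canon lab (flip p) ≡ flip p
  canon-flip (v , c) with lab v
  ... | true = refl
  ... | false = refl

  flip-involutive : ∀ {p} → canon lab p ≡ p → flip (flip p) ≡ p
  flip-involutive {v , c} canonical with lab v
  flip-involutive {v , false} _ | true = refl
  flip-involutive {v , true} () | true
  flip-involutive {v , false} _ | false = refl
  flip-involutive {v , true} _ | false = refl

  private
    copies-agree : ∀ a b c d → sameCopy c d ∨ a ∨ b ≡ sameCopy (not a ∧ not c) (not b ∧ not d) ∨ a ∨ b
    copies-agree true _ _ _ = trans (∨-zeroʳ _) (≡-sym (∨-zeroʳ _))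
    copies-agree false true _ _ = trans (∨-zeroʳ _) (≡-sym (∨-zeroʳ _))
    copies-agree false false true true = refl
    copies-agree false false true false = refl
    copies-agree false false false true = refl
    copies-agree false false false false = refl

  KKadj-flip : ∀ p q → KKadj K lab p q ≡ KKadj K lab (flip p) (flip q)
  KKadj-flip (v , c) (w , d) = cong (adj K v w ∧_) (copies-agree (lab v) (lab w) c d)

  flip-labelled : ∀ {p} → canon lab p ≡ p → partOf p ≡ labelled → flip p ≡ p
  flip-labelled {v , c} canonical e with lab v
  flip-labelled {v , false} _ _ | true = refl
  flip-labelled {v , true} () _ | true
  flip-labelled {v , false} _ () | false
  flip-labelled {v , true} _ () | false

  partOf-flip : ∀ p → partOf (flip p) ≡ opposite (partOf p)
  partOf-flip (v , c) with lab v
  partOf-flip (v , c) | true = refl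
  partOf-flip (v , true) | false = refl
  partOf-flip (v , false) | false = refl

  KKadj-first-second : ∀ {p q} → partOf p ≡ first → partOf q ≡ second → KKadj K lab p q ≡ false
  KKadj-first-second {v , c} {w , d} e e′ with lab v | lab w
  KKadj-first-second {v , false} {w , true} _ _ | false | false = ∧-zeroʳ _
  KKadj-first-second {v , true} {w , _} () _ | false | _
  KKadj-first-second {v , _} {w , false} _ () | _ | false
  KKadj-first-second {v , _} {w , _} () _ | true | _
  KKadj-first-second {v , _} {w , _} _ () | _ | true

  partOf-canon-labelled : ∀ {v} c → lab v ≡ true → partOf (canon lab (v , c)) ≡ labelled
  partOf-canon-labelled _ e rewrite e = refl

  partOf-canon-unlabelled : ∀ {v} → lab v ≡ false → partOf (canon lab (v , false)) ≡ first
  partOf-canon-unlabelled e rewrite e = refl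

IsSquare⇒ProperCopySwap : ∀ {G} → IsSquare G → ProperCopySwap (adj G)
IsSquare⇒ProperCopySwap {G} (K , lab , (v , lab-v) , (w , lab-w) , I) = record
  { copySwap = record
    { σ = σ
    ; part = partOf ∘ to
    ; σ-involutive = σ-involutive
    ; σ-automorphism = σ-automorphism
    ; σ-fixes-labelled = λ {x} e → trans (cong from (flip-labelled (to-canon x) e)) (from∘to x)
    ; part-σ = λ x → trans (cong partOf (to-σ x)) (partOf-flip (to x))
    ; first-second-nonadjacent = λ {x} {y} ex ey → trans (adj-pres x y) (KKadj-first-second ex ey)
    }
  ; labelled-vertex = from (v , false) , trans (cong partOf (to∘from _)) (partOf-canon-labelled false lab-v)
  ; first-vertex = from (w , false) , trans (cong partOf (to∘from _)) (partOf-canon-unlabelled lab-w)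
  }
  where
  open IsoToSquare I
  open SquareCopySwap K lab
  open ≡-Reasoning

  σ : Fin (n G) → Fin (n G)
  σ x = from (flip (to x))

  to-σ : ∀ x → to (σ x) ≡ flip (to x)
  to-σ x = trans (to∘from _) (canon-flip (to x))

  σ-involutive : ∀ x → σ (σ x) ≡ x
  σ-involutive x = begin
    from (flip (to (σ x)))     ≡⟨ cong (from ∘ flip) (to-σ x) ⟩
    from (flip (flip (to x)))  ≡⟨ cong from (flip-involutive (to-canon x)) ⟩
    from (to x)                ≡⟨ from∘to x ⟩
    x                          ∎

  σ-automorphism : ∀ x y → adj G x y ≡ adj G (σ x) (σ y)
  σ-automorphism x y = begin
    adj G x y                                  ≡⟨ adj-pres x y ⟩
    KKadj K lab (to x) (to y)                  ≡⟨ KKadj-flip (to x) (to y) ⟩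
    KKadj K lab (flip (to x)) (flip (to y))    ≡⟨ cong₂ (KKadj K lab) (to-σ x) (to-σ y) ⟨
    KKadj K lab (to (σ x)) (to (σ y))          ≡⟨ adj-pres (σ x) (σ y) ⟨
    adj G (σ x) (σ y)                          ∎

inFirstCopy : Part → Bool
inFirstCopy labelled = true
inFirstCopy first = true
inFirstCopy second = false

isLabelled : Part → Bool
isLabelled labelled = true
isLabelled _ = false

isSecond : Part → Bool
isSecond second = true
isSecond _ = false

representativePart : Part → Part
representativePart second = first
representativePart p = p

-- K is the subgraph induced by the labelled and first vertices; a second vertex x is the copy
-- of its partner σ x in the second copy of K.
module SquareOfCopySwap (G : Graph) (S : ProperCopySwap (adj G)) where
  open ProperCopySwap S
  open Enumeration (inFirstCopy ∘ part)

  K : Graph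
  K = record
    { n = size
    ; adj = λ i j → adj G (element i) (element j)
    ; sym = λ i j → sym G (element i) (element j)
    ; irrefl = λ i → irrefl G (element i)
    }

  lab : Fin size → Bool
  lab i = isLabelled (part (element i))

  representative : Part → Fin (n G) → Fin (n G)
  representative second x = σ x
  representative _ x = x

  rep : Fin (n G) → Fin (n G)
  rep x = representative (part x) x

  part-rep : ∀ x → part (rep x) ≡ representativePart (part x)
  part-rep x with part x in e
  ... | labelled = e
  ... | first = e
  ... | second = trans (part-σ x) (cong opposite e)

  rep-inFirstCopy : ∀ x → inFirstCopy (part (rep x)) ≡ true
  rep-inFirstCopy x = trans (cong inFirstCopy (part-rep x)) (inFirstCopy-representativePart (part x))
    where
    inFirstCopy-representativePart : ∀ p → inFirstCopy (representativePart p) ≡ true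
    inFirstCopy-representativePart labelled = refl
    inFirstCopy-representativePart first = refl
    inFirstCopy-representativePart second = refl

  copy : Fin (n G) → Bool
  copy x = isSecond (part x)

  to : Fin (n G) → Fin size × Bool
  to x = position (rep x) (rep-inFirstCopy x) , copy x

  from : Fin size × Bool → Fin (n G)
  from (i , c) = if c then σ (element i) else element i

  element-to : ∀ x → element (proj₁ (to x)) ≡ rep x
  element-to x = element-position (rep x) (rep-inFirstCopy x)

  lab-to : ∀ x → lab (proj₁ (to x)) ≡ isLabelled (part x)
  lab-to x = begin
    isLabelled (part (element (proj₁ (to x))))  ≡⟨ cong (isLabelled ∘ part) (element-to x) ⟩
    isLabelled (part (rep x))                   ≡⟨ cong isLabelled (part-rep x) ⟩
    isLabelled (representativePart (part x))    ≡⟨ isLabelled-representativePart (part x) ⟩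
    isLabelled (part x)                         ∎
    where
    open ≡-Reasoning
    isLabelled-representativePart : ∀ p → isLabelled (representativePart p) ≡ isLabelled p
    isLabelled-representativePart labelled = refl
    isLabelled-representativePart first = refl
    isLabelled-representativePart second = refl

  to-canon : ∀ x → canon lab (to x) ≡ to x
  to-canon x = cong (proj₁ (to x) ,_)
    (trans (cong (λ b → not b ∧ copy x) (lab-to x)) (second-unlabelled (part x)))
    where
    second-unlabelled : ∀ p → not (isLabelled p) ∧ isSecond p ≡ isSecond p
    second-unlabelled labelled = refl
    second-unlabelled first = refl
    second-unlabelled second = refl

  from∘to : ∀ x → from (to x) ≡ x
  from∘to x = trans (cong (λ y → if copy x then σ y else y) (element-to x)) (unfold-rep x)
    where
    unfold-rep : ∀ x → (if copy x then σ (rep x) else rep x) ≡ x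
    unfold-rep x with part x
    ... | labelled = refl
    ... | first = refl
    ... | second = σ-involutive x

  to-position : ∀ {x i} → rep x ≡ element i → to x ≡ (i , copy x)
  to-position {x} {i} e = cong (_, copy x) (position-element i (rep-inFirstCopy x) (≡-sym e))

  to-element : ∀ i → to (element i) ≡ (i , false)
  to-element i =
    trans (to-position (rep-unflipped (element-p i))) (cong (i ,_) (isSecond-unflipped (element-p i)))
    where
    rep-unflipped : ∀ {x} → inFirstCopy (part x) ≡ true → rep x ≡ x
    rep-unflipped {x} e with part x
    ... | labelled = refl
    ... | first = refl
    isSecond-unflipped : ∀ {p} → inFirstCopy p ≡ true → isSecond p ≡ false
    isSecond-unflipped {labelled} _ = refl
    isSecond-unflipped {first} _ = refl

  to∘from : ∀ p → to (from p) ≡ canon lab p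
  to∘from (i , false) = trans (to-element i) (cong (i ,_) (≡-sym (∧-zeroʳ _)))
  to∘from (i , true) with part (element i) in e | element-p i
  ... | labelled | _ = trans (cong to (σ-fixes-labelled e)) (to-element i)
  ... | first | _ = trans (to-position rep-σ) (cong (λ p → i , isSecond p) σ-second)
    where
    σ-second : part (σ (element i)) ≡ second
    σ-second = trans (part-σ (element i)) (cong opposite e)
    rep-σ : rep (σ (element i)) ≡ element i
    rep-σ = trans (cong (λ p → representative p (σ (element i))) σ-second) (σ-involutive (element i))

  adj-rep : ∀ x y →
    adj G x y ≡ adj G (rep x) (rep y) ∧ (sameCopy (copy x) (copy y) ∨ isLabelled (part x) ∨ isLabelled (part y))
  adj-rep x y with part x in ex | part y in ey
  ... | labelled | labelled = ≡-sym (∧-identityʳ _)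
  ... | labelled | first = ≡-sym (∧-identityʳ _)
  ... | first | labelled = ≡-sym (∧-identityʳ _)
  ... | first | first = ≡-sym (∧-identityʳ _)
  ... | second | second = trans (σ-automorphism x y) (≡-sym (∧-identityʳ _))
  ... | labelled | second =
    trans (σ-automorphism x y) (trans (cong (λ z → adj G z (σ y)) (σ-fixes-labelled ex)) (≡-sym (∧-identityʳ _)))
  ... | second | labelled =
    trans (σ-automorphism x y) (trans (cong (adj G (σ x)) (σ-fixes-labelled ey)) (≡-sym (∧-identityʳ _)))
  ... | first | second = trans (first-second-nonadjacent ex ey) (≡-sym (∧-zeroʳ _))
  ... | second | first = trans (sym G x y) (trans (first-second-nonadjacent ey ex) (≡-sym (∧-zeroʳ _)))

  adj-pres : ∀ x y → adj G x y ≡ KKadj K lab (to x) (to y)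
  adj-pres x y = trans (adj-rep x y) (≡-sym (cong₂ (λ a b → a ∧ (sameCopy (copy x) (copy y) ∨ b))
    (cong₂ (adj G) (element-to x) (element-to y)) (cong₂ _∨_ (lab-to x) (lab-to y))))

ProperCopySwap⇒IsSquare : ∀ {G} → ProperCopySwap (adj G) → IsSquare G
ProperCopySwap⇒IsSquare {G} S = K , lab , labelled-position , unlabelled-position , record
  { to = to ; from = from ; to-canon = to-canon ; from∘to = from∘to ; to∘from = to∘from ; adj-pres = adj-pres }
  where
  open SquareOfCopySwap G S
  open ProperCopySwap S using (labelled-vertex; first-vertex)

  labelled-position : ∃[ i ] lab i ≡ true
  labelled-position = proj₁ (to (proj₁ labelled-vertex)) , trans (lab-to _) (cong isLabelled (proj₂ labelled-vertex))

  unlabelled-position : ∃[ i ] lab i ≡ false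
  unlabelled-position = proj₁ (to (proj₁ first-vertex)) , trans (lab-to _) (cong isLabelled (proj₂ first-vertex))

IsSquare⇔ProperCopySwap : ∀ {G} → IsSquare G ⇔ ProperCopySwap (adj G)
IsSquare⇔ProperCopySwap = mk⇔ IsSquare⇒ProperCopySwap ProperCopySwap⇒IsSquare

unlabelled⇒twoIsomorphicComponents : ∀ G (C : CopySwap (adj G)) → (∀ x → CopySwap.part C x ≢ labelled) →
  ∀ {v} → CopySwap.part C v ≡ first → ¬ Connected G × HasTwoIsoComponents G
unlabelled⇒twoIsomorphicComponents G C unlabelled {v} v-first =
  (λ connected → v↛σv (connected v (σ v))) , v , σ v , v↛σv , σ-componentIso
  where
  open CopySwap C

  first-closed : ∀ {x y} → Reach G x y → part x ≡ first → part y ≡ first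
  first-closed here ex = ex
  first-closed (step {y = z} e r) ex with part z in ez
  ... | labelled = contradiction ez (unlabelled z)
  ... | first = first-closed r ez
  ... | second = contradiction (trans (≡-sym e) (first-second-nonadjacent ex ez)) λ ()

  σ-Reach : ∀ {x y} → Reach G x y → Reach G (σ x) (σ y)
  σ-Reach here = here
  σ-Reach (step {x} {z} e r) = step (trans (≡-sym (σ-automorphism x z)) e) (σ-Reach r)

  v↛σv : ¬ Reach G v (σ v)
  v↛σv r = contradiction (trans (≡-sym (first-closed r v-first)) (trans (part-σ v) (cong opposite v-first))) λ ()

  σ-componentIso : ComponentIso G v (σ v)
  σ-componentIso = record
    { f = σ
    ; g = σ
    ; f-into = λ _ → σ-Reach
    ; g-into = λ y r → subst (λ z → Reach G z (σ y)) (σ-involutive v) (σ-Reach r)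
    ; g∘f = λ x _ → σ-involutive x
    ; f∘g = λ y _ → σ-involutive y
    ; adj-pres = λ x y _ _ → σ-automorphism x y
    }

module ComponentSwap (G : Graph) {u v : Fin (n G)} (u↛v : ¬ Reach G u v) (I : ComponentIso G u v) where
  open ComponentIso I

  disjoint : ∀ {x} → Reach G u x → ¬ Reach G v x
  disjoint ux vx = u↛v (Reach-trans ux (Reach-sym vx))

  part : Fin (n G) → Part
  part x with Reach? G u x | Reach? G v x
  ... | yes _ | _ = first
  ... | no _ | yes _ = second
  ... | no _ | no _ = labelled

  data PartView (x : Fin (n G)) : Part → Set where
    first-view : Reach G u x → PartView x first
    second-view : ¬ Reach G u x → Reach G v x → PartView x second
    labelled-view : ¬ Reach G u x → ¬ Reach G v x → PartView x labelled

  partView : ∀ x → PartView x (part x)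
  partView x with Reach? G u x | Reach? G v x
  ... | yes ux | _ = first-view ux
  ... | no u↛x | yes vx = second-view u↛x vx
  ... | no u↛x | no v↛x = labelled-view u↛x v↛x

  part-first : ∀ {x} → Reach G u x → part x ≡ first
  part-first {x} ux with part x | partView x
  ... | _ | first-view _ = refl
  ... | _ | second-view u↛x _ = contradiction ux u↛x
  ... | _ | labelled-view u↛x _ = contradiction ux u↛x

  part-second : ∀ {x} → Reach G v x → part x ≡ second
  part-second {x} vx with part x | partView x
  ... | _ | first-view ux = contradiction vx (disjoint ux)
  ... | _ | second-view _ _ = refl
  ... | _ | labelled-view _ v↛x = contradiction vx v↛x

  swapBy : Part → Fin (n G) → Fin (n G)
  swapBy first = f
  swapBy second = g
  swapBy labelled x = x

  σ : Fin (n G) → Fin (n G)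
  σ x = swapBy (part x) x

  σ-first : ∀ {x} → Reach G u x → σ x ≡ f x
  σ-first {x} ux = cong (λ p → swapBy p x) (part-first ux)

  σ-second : ∀ {x} → Reach G v x → σ x ≡ g x
  σ-second {x} vx = cong (λ p → swapBy p x) (part-second vx)

  σ-fixes-labelled : ∀ {x} → part x ≡ labelled → σ x ≡ x
  σ-fixes-labelled {x} e = cong (λ p → swapBy p x) e

  σ-involutive : ∀ x → σ (σ x) ≡ x
  σ-involutive x with part x in e | partView x
  ... | _ | first-view ux = trans (σ-second (f-into x ux)) (g∘f x ux)
  ... | _ | second-view _ vx = trans (σ-first (g-into x vx)) (f∘g x vx)
  ... | _ | labelled-view _ _ = σ-fixes-labelled e

  part-σ : ∀ x → part (σ x) ≡ opposite (part x)
  part-σ x with part x in e | partView x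
  ... | _ | first-view ux = part-second (f-into x ux)
  ... | _ | second-view _ vx = part-first (g-into x vx)
  ... | _ | labelled-view _ _ = e

  σ-preserves-edges : ∀ {x y} → adj G x y ≡ true → adj G (σ x) (σ y) ≡ true
  σ-preserves-edges {x} {y} e with part x | partView x | part y | partView y
  ... | _ | first-view ux | _ | first-view uy = trans (≡-sym (adj-pres x y ux uy)) e
  ... | _ | first-view ux | _ | second-view u↛y _ = contradiction (Reach-snoc ux e) u↛y
  ... | _ | first-view ux | _ | labelled-view u↛y _ = contradiction (Reach-snoc ux e) u↛y
  ... | _ | second-view u↛x _ | _ | first-view uy = contradiction (Reach-snoc uy (trans (sym G y x) e)) u↛x
  ... | _ | second-view _ vx | _ | second-view _ vy =
    trans (adj-pres (g x) (g y) (g-into x vx) (g-into y vy)) (trans (cong₂ (adj G) (f∘g x vx) (f∘g y vy)) e)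
  ... | _ | second-view _ vx | _ | labelled-view _ v↛y = contradiction (Reach-snoc vx e) v↛y
  ... | _ | labelled-view u↛x _ | _ | first-view uy = contradiction (Reach-snoc uy (trans (sym G y x) e)) u↛x
  ... | _ | labelled-view _ v↛x | _ | second-view _ vy = contradiction (Reach-snoc vy (trans (sym G y x) e)) v↛x
  ... | _ | labelled-view _ _ | _ | labelled-view _ _ = e

  first-second-nonadjacent : ∀ {x y} → part x ≡ first → part y ≡ second → adj G x y ≡ false
  first-second-nonadjacent {x} {y} ex ey with part x | partView x | part y | partView y
  ... | _ | first-view ux | _ | second-view u↛y _ = Reach-boundary ux u↛y

  componentSwap : NontrivialCopySwap (adj G)
  componentSwap = record
    { σ = σ
    ; part = part
    ; σ-involutive = σ-involutive
    ; σ-automorphism = involution-preserving-edges⇒automorphism σ-involutive σ-preserves-edges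
    ; σ-fixes-labelled = σ-fixes-labelled
    ; part-σ = part-σ
    ; first-second-nonadjacent = first-second-nonadjacent
    } , u , part-first here

IsSquareOrTwoIsoComponents : Graph → Set
IsSquareOrTwoIsoComponents G = IsSquare G ⊎ (¬ Connected G × HasTwoIsoComponents G)

IsSquareOrTwoIsoComponents⇔NontrivialCopySwap : ∀ G → IsSquareOrTwoIsoComponents G ⇔ NontrivialCopySwap (adj G)
IsSquareOrTwoIsoComponents⇔NontrivialCopySwap G = mk⇔ nontrivialCopySwap squareOrTwoIsoComponents
  where
  nontrivialCopySwap : IsSquareOrTwoIsoComponents G → NontrivialCopySwap (adj G)
  nontrivialCopySwap (inj₁ square) = ProperCopySwap.nontrivial (IsSquare⇒ProperCopySwap square)
  nontrivialCopySwap (inj₂ (_ , _ , _ , u↛v , I)) = ComponentSwap.componentSwap G u↛v I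

  squareOrTwoIsoComponents : NontrivialCopySwap (adj G) → IsSquareOrTwoIsoComponents G
  squareOrTwoIsoComponents (C , v-first) with any? (labelled? ∘ CopySwap.part C)
  ... | yes labelled-vertex =
    inj₁ (ProperCopySwap⇒IsSquare record { copySwap = C ; labelled-vertex = labelled-vertex ; first-vertex = v-first })
  ... | no unlabelled =
    inj₂ (unlabelled⇒twoIsomorphicComponents G C (λ x e → unlabelled (x , e)) (proj₂ v-first))

module _ (G H : Graph) where

  ProperCopySwap-∇⇔joinAdj : ProperCopySwap (adj (G ∇ H)) ⇔ ProperCopySwap (joinAdj G H)
  ProperCopySwap-∇⇔joinAdj = transportCopySwap-⇔ +↔⊎ (λ _ _ → refl)

  swapJoin : ProperCopySwap (joinAdj G H) → ProperCopySwap (joinAdj H G)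
  swapJoin = transportCopySwap swap-↔ swap-preserves
    where
    swap-preserves : Preserves swap-↔ (joinAdj G H) (joinAdj H G)
    swap-preserves (inj₁ _) (inj₁ _) = refl
    swap-preserves (inj₁ _) (inj₂ _) = refl
    swap-preserves (inj₂ _) (inj₁ _) = refl
    swap-preserves (inj₂ _) (inj₂ _) = refl

  extendToJoin : NontrivialCopySwap (adj G) → Fin (n H) → ProperCopySwap (joinAdj G H)
  extendToJoin (C , first-vertex) w = record
    { copySwap = record
      { σ = map₁ σ
      ; part = [ part , const labelled ]
      ; σ-involutive = λ { (inj₁ a) → cong inj₁ (σ-involutive a) ; (inj₂ _) → refl }
      ; σ-automorphism = automorphism
      ; σ-fixes-labelled = λ { {inj₁ _} e → cong inj₁ (σ-fixes-labelled e) ; {inj₂ _} _ → refl }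
      ; part-σ = λ { (inj₁ a) → part-σ a ; (inj₂ _) → refl }
      ; first-second-nonadjacent = λ
          { {inj₁ _} {inj₁ _} ex ey → first-second-nonadjacent ex ey
          ; {inj₁ _} {inj₂ _} _ ()
          ; {inj₂ _} () _
          }
      }
    ; labelled-vertex = inj₂ w , refl
    ; first-vertex = inj₁ (proj₁ first-vertex) , proj₂ first-vertex
    }
    where
    open CopySwap C

    automorphism : ∀ a b → joinAdj G H a b ≡ joinAdj G H (map₁ σ a) (map₁ σ b)
    automorphism (inj₁ a) (inj₁ b) = σ-automorphism a b
    automorphism (inj₁ _) (inj₂ _) = refl
    automorphism (inj₂ _) (inj₁ _) = refl
    automorphism (inj₂ _) (inj₂ _) = refl

  -- Every vertex of H is adjacent to the first vertex v and to its second partner, so none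
  -- of them can be first or second.
  restrictJoin : (S : ProperCopySwap (joinAdj G H)) → ∀ {v} → ProperCopySwap.part S (inj₁ v) ≡ first →
    NontrivialCopySwap (adj G)
  restrictJoin S {v} v-first = restrictCopySwapˡ copySwap σ-inj₁ , v , v-first
    where
    open ProperCopySwap S

    partner-second : part (σ (inj₁ v)) ≡ second
    partner-second = trans (part-σ (inj₁ v)) (cong opposite v-first)

    partner-in-G : ∃[ v′ ] σ (inj₁ v) ≡ inj₁ v′
    partner-in-G with σ (inj₁ v) in e
    ... | inj₁ v′ = v′ , refl
    ... | inj₂ w =
      contradiction (first-second-nonadjacent v-first (subst (λ x → part x ≡ second) e partner-second)) λ ()

    H-labelled : ∀ w → part (inj₂ w) ≡ labelled
    H-labelled w with part (inj₂ w) in e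
    ... | labelled = refl
    ... | first =
      contradiction (first-second-nonadjacent e (subst (λ x → part x ≡ second) (proj₂ partner-in-G) partner-second)) λ ()
    ... | second = contradiction (first-second-nonadjacent v-first e) λ ()

    σ-inj₁ : ∀ u → ∃[ u′ ] σ (inj₁ u) ≡ inj₁ u′
    σ-inj₁ u with σ (inj₁ u) in e
    ... | inj₁ u′ = u′ , refl
    ... | inj₂ w =
      contradiction (trans (≡-sym (σ-involutive (inj₁ u))) (trans (cong σ e) (σ-fixes-labelled (H-labelled w)))) λ ()

ProperCopySwap-join⇔NontrivialCopySwap-⊎ : ∀ G H → Fin (n G) → Fin (n H) →
  ProperCopySwap (joinAdj G H) ⇔ (NontrivialCopySwap (adj G) ⊎ NontrivialCopySwap (adj H))
ProperCopySwap-join⇔NontrivialCopySwap-⊎ G H v w = mk⇔ restrict extend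
  where
  restrict : ProperCopySwap (joinAdj G H) → NontrivialCopySwap (adj G) ⊎ NontrivialCopySwap (adj H)
  restrict S with ProperCopySwap.first-vertex S
  ... | inj₁ _ , e = inj₁ (restrictJoin G H S e)
  ... | inj₂ _ , e = inj₂ (restrictJoin H G (swapJoin G H S) e)

  extend : NontrivialCopySwap (adj G) ⊎ NontrivialCopySwap (adj H) → ProperCopySwap (joinAdj G H)
  extend (inj₁ C) = extendToJoin G H C w
  extend (inj₂ C) = swapJoin H G (extendToJoin H G C v)

theorem5p9 : (G H : Graph) → n G ≥ 1 → n H ≥ 1 →
    IsSquare (G ∇ H) ⇔
      ((IsSquare G ⊎ (¬ Connected G × HasTwoIsoComponents G)) ⊎
       (IsSquare H ⊎ (¬ Connected H × HasTwoIsoComponents H)))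
theorem5p9 G H nG≥1 nH≥1 =
  ⇔-trans IsSquare⇔ProperCopySwap
  (⇔-trans (ProperCopySwap-∇⇔joinAdj G H)
  (⇔-trans (ProperCopySwap-join⇔NontrivialCopySwap-⊎ G H (fromℕ< nG≥1) (fromℕ< nH≥1))
           (⇔-sym (IsSquareOrTwoIsoComponents⇔NontrivialCopySwap G
                   ⊎-⇔ IsSquareOrTwoIsoComponents⇔NontrivialCopySwap H))))
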